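{- Let $G$ be a (finite, not necessarily connected) bipartite graph. Then A wins the gp achievement game on $G$ if and only if the number of isolated vertices in $G$ is odd.
   Context: A general position set of a graph $G$ is a set $S\subseteq V(G)$ such that no three vertices of $S$ lie on a common shortest path of $G$. The gp achievement game on $G$: players A and B alternately select vertices of $G$, A first; a selection of a vertex is legal if it has not been selected before and the set of all vertices selected so far (including it) is a general position set of $G$. The game ends when no legal move exists, and the player who selected the last vertex wins; "a player wins the game" means that player has a winning strategy. -}

module Defs where

open import Data.Nat using (ℕ; zero; suc; _+_; _<_; _%_)
open import Data.Fin using (Fin)
open import Data.Bool using (Bool; T; true; false; not; _≟_)
open import Data.List using (List; []; _∷_; length; filter)
open import Data.List.Membership.Propositional using (_∈_; _∉_)
open import Data.Fin.Properties using () renaming (all? to allFin?)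
open import Data.Product using (Σ; ∃; _×_; _,_)
open import Relation.Nullary using (¬_; Dec)
open import Relation.Binary.PropositionalEquality using (_≡_; _≢_)
import Data.Vec as Vec

record Graph : Set where
  field
    n     : ℕ
    adj   : Fin n → Fin n → Bool
    sym   : ∀ u v → adj u v ≡ adj v u
    irrefl : ∀ v → adj v v ≡ false

open Graph public

Adj : (G : Graph) → Fin (n G) → Fin (n G) → Set
Adj G u v = T (adj G u v)

Bipartite : Graph → Set
Bipartite G = Σ (Fin (n G) → Bool) λ c → ∀ u v → Adj G u v → c u ≢ c v

data Walk (G : Graph) : Fin (n G) → Fin (n G) → ℕ → Set where
  here : ∀ {u} → Walk G u u zero
  step : ∀ {u w v k} → Adj G u w → Walk G w v k → Walk G u v (suc k)

verts : ∀ {G u v k} → Walk G u v k → List (Fin (n G))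
verts {u = u} here = u ∷ []
verts {u = u} (step _ p) = u ∷ verts p

IsShortest : ∀ {G u v k} → Walk G u v k → Set
IsShortest {G} {u} {v} {k} _ = ∀ {m} → Walk G u v m → ¬ (m < k)

OnCommonShortestPath : (G : Graph) → (x y z : Fin (n G)) → Set
OnCommonShortestPath G x y z =
  Σ (Fin (n G)) λ u → Σ (Fin (n G)) λ v → Σ ℕ λ k → Σ (Walk G u v k) λ p →
    IsShortest p × x ∈ verts p × y ∈ verts p × z ∈ verts p

IsGPSet : (G : Graph) → List (Fin (n G)) → Set
IsGPSet G S = ∀ {x y z} → x ∈ S → y ∈ S → z ∈ S →
  x ≢ y → y ≢ z → x ≢ z → ¬ OnCommonShortestPath G x y z

Legal : (G : Graph) → List (Fin (n G)) → Fin (n G) → Set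
Legal G s v = v ∉ s × IsGPSet G (v ∷ s)

-- gp achievement game (normal play): at position s (vertices selected so far),
-- the player to move wins / loses (has a winning strategy / opponent has one)
mutual
  data MoverWins (G : Graph) (s : List (Fin (n G))) : Set where
    move : (v : Fin (n G)) → Legal G s v → MoverLoses G (v ∷ s) → MoverWins G s

  data MoverLoses (G : Graph) (s : List (Fin (n G))) : Set where
    allMoves : (∀ v → Legal G s v → MoverWins G (v ∷ s)) → MoverLoses G s

AWins : Graph → Set
AWins G = MoverWins G []

Isolated : (G : Graph) → Fin (n G) → Set
Isolated G v = ∀ u → ¬ Adj G u v

isolated? : (G : Graph) → (v : Fin (n G)) → Dec (Isolated G v)
isolated? G v = allFin? (λ u → Relation.Nullary.¬? (Data.Bool.T? (adj G u v)))
  where import Relation.Nullary; import Data.Bool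

numIsolated : Graph → ℕ
numIsolated G = length (filter (isolated? G) (Data.List.allFin (n G)))
  where import Data.List

-- The player to move loses from any position in which every selected non-isolated vertex
-- has a selected neighbour and an even number of isolated vertices is unselected: the
-- opponent answers an isolated vertex by another isolated vertex and any other vertex v by
-- a neighbour u. The answer u is legal because in a bipartite graph an edge x y and any
-- vertex v of its component lie on a common shortest path (the distances from v to x and
-- to y have different parities, so they differ by exactly one); hence a legally selected v
-- lies in a component containing no earlier selected vertex, and so does u. A therefore
-- wins exactly when the number of isolated vertices is odd, by first taking one of them.
{-# OPTIONS --safe #-}
module Submission where

open import Defs hiding (sym)
open import Data.Bool using (Bool; not; T)
open import Data.Bool.Properties using (T?; ¬-not)
open import Data.Empty using (⊥; ⊥-elim)
open import Data.Fin using (Fin; toℕ; fromℕ<) renaming (_≟_ to _≟ᶠ_)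
open import Data.Fin.Properties using (any?; toℕ<n; toℕ-fromℕ<)
open import Data.List using (List; []; _∷_; length; filter; allFin)
open import Data.List.Membership.Propositional using (_∈_; _∉_)
open import Data.List.Membership.Propositional.Properties using (∈-allFin; ∈-filter⁻)
import Data.List.Membership.DecPropositional as DecMembership
open import Data.List.Properties using (filter-accept; filter-reject; filter-≐)
open import Data.List.Relation.Unary.All as All using ()
open import Data.List.Relation.Unary.All.Properties using (All¬⇒¬Any)
open import Data.List.Relation.Unary.AllPairs using (_∷_)
open import Data.List.Relation.Unary.Any using (here; there)
open import Data.List.Relation.Unary.Unique.Propositional using (Unique)
open import Data.List.Relation.Unary.Unique.Propositional.Properties using (allFin⁺)
open import Data.Nat using (ℕ; zero; suc; _+_; _<_; _%_; z<s)
open import Data.Nat.GeneralisedArithmetic using (iterate)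
open import Data.Nat.Induction using (<-wellFounded)
open import Data.Nat.Properties using (<-cmp; ≤-trans; <-trans; ≤-reflexive)
open import Data.Product using (Σ; ∃-syntax; _×_; _,_; proj₁; proj₂)
open import Data.Sum using (_⊎_; inj₁; inj₂)
open import Data.Unit using (tt)
open import Function using (_∘_)
open import Function.Bundles using (_⇔_; mk⇔)
open import Induction.WellFounded using (Acc; acc)
open import Level using (0ℓ)
open import Relation.Binary.Definitions using (tri<; tri≈; tri>)
open import Relation.Binary.PropositionalEquality
  using (_≡_; _≢_; refl; sym; trans; cong; subst; ≢-sym; module ≡-Reasoning)
open import Relation.Nullary using (¬_; Dec; yes; no; _×-dec_)
open import Relation.Unary using (Pred; Decidable)
open import Relation.Unary.Properties using (U?)

m%2≡0⊎m%2≡1 : ∀ m → m % 2 ≡ 0 ⊎ m % 2 ≡ 1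
m%2≡0⊎m%2≡1 zero = inj₁ refl
m%2≡0⊎m%2≡1 (suc zero) = inj₂ refl
m%2≡0⊎m%2≡1 (suc (suc m)) = m%2≡0⊎m%2≡1 m

1+m≡k⇒k%2≡0⇒m%2≡1 : ∀ {m k} → suc m ≡ k → k % 2 ≡ 0 → m % 2 ≡ 1
1+m≡k⇒k%2≡0⇒m%2≡1 {zero} refl ()
1+m≡k⇒k%2≡0⇒m%2≡1 {suc zero} refl _ = refl
1+m≡k⇒k%2≡0⇒m%2≡1 {suc (suc m)} refl = 1+m≡k⇒k%2≡0⇒m%2≡1 {m} refl

1+m≡k⇒k%2≡1⇒m%2≡0 : ∀ {m k} → suc m ≡ k → k % 2 ≡ 1 → m % 2 ≡ 0
1+m≡k⇒k%2≡1⇒m%2≡0 {zero} refl _ = refl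
1+m≡k⇒k%2≡1⇒m%2≡0 {suc zero} refl ()
1+m≡k⇒k%2≡1⇒m%2≡0 {suc (suc m)} refl = 1+m≡k⇒k%2≡1⇒m%2≡0 {m} refl

m%2≡1⇒0<m : ∀ m → m % 2 ≡ 1 → 0 < m
m%2≡1⇒0<m (suc m) _ = z<s

module _ {m : ℕ} {P : Pred (Fin m) 0ℓ} (P? : Decidable P) where
  open ≡-Reasoning
  open DecMembership (_≟ᶠ_ {m}) using (_∉?_)

  Unselected : List (Fin m) → Pred (Fin m) 0ℓ
  Unselected s x = P x × x ∉ s

  unselected? : ∀ s → Decidable (Unselected s)
  unselected? s x = P? x ×-dec x ∉? s

  unselected : List (Fin m) → ℕ
  unselected s = length (filter (unselected? s) (allFin m))

  unselected-[] : unselected [] ≡ length (filter P? (allFin m))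
  unselected-[] = cong length (filter-≐ (unselected? []) P? (proj₁ , λ p → p , λ ()) (allFin m))

  unselected-∷⁻ : ∀ {y s x} → Unselected (y ∷ s) x → Unselected s x
  unselected-∷⁻ (p , x∉) = p , x∉ ∘ there

  unselected-∷⁺ : ∀ {y s x} → x ≢ y → Unselected s x → Unselected (y ∷ s) x
  unselected-∷⁺ x≢y (p , x∉s) = p , λ { (here x≡y) → x≢y x≡y ; (there x∈s) → x∉s x∈s }

  unselected-∷-¬P : ∀ {y} s → ¬ P y → unselected (y ∷ s) ≡ unselected s
  unselected-∷-¬P {y} s ¬Py = cong length (filter-≐ (unselected? (y ∷ s)) (unselected? s)
    (unselected-∷⁻ , λ {x} u → unselected-∷⁺ (λ { refl → ¬Py (proj₁ u) }) u) (allFin m))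

  filter-unselected-∷-∉ : ∀ {y s} xs → y ∉ xs →
    filter (unselected? (y ∷ s)) xs ≡ filter (unselected? s) xs
  filter-unselected-∷-∉ [] _ = refl
  filter-unselected-∷-∉ {y} {s} (x ∷ xs) y∉x∷xs with unselected? s x
  ... | yes u = begin
    filter (unselected? (y ∷ s)) (x ∷ xs)
      ≡⟨ filter-accept (unselected? (y ∷ s)) (unselected-∷⁺ x≢y u) ⟩
    x ∷ filter (unselected? (y ∷ s)) xs
      ≡⟨ cong (x ∷_) (filter-unselected-∷-∉ xs (y∉x∷xs ∘ there)) ⟩
    x ∷ filter (unselected? s) xs
      ≡⟨ filter-accept (unselected? s) u ⟨
    filter (unselected? s) (x ∷ xs) ∎
    where x≢y : x ≢ y
          x≢y x≡y = y∉x∷xs (here (sym x≡y))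
  ... | no ¬u = begin
    filter (unselected? (y ∷ s)) (x ∷ xs)
      ≡⟨ filter-reject (unselected? (y ∷ s)) (¬u ∘ unselected-∷⁻) ⟩
    filter (unselected? (y ∷ s)) xs
      ≡⟨ filter-unselected-∷-∉ xs (y∉x∷xs ∘ there) ⟩
    filter (unselected? s) xs
      ≡⟨ filter-reject (unselected? s) ¬u ⟨
    filter (unselected? s) (x ∷ xs) ∎

  length-filter-unselected-∷ : ∀ {y s} → P y → y ∉ s → ∀ xs → Unique xs → y ∈ xs →
    suc (length (filter (unselected? (y ∷ s)) xs)) ≡ length (filter (unselected? s) xs)
  length-filter-unselected-∷ {y} {s} Py y∉s (x ∷ xs) (y≢xs ∷ _) (here refl) = begin
    suc (length (filter (unselected? (y ∷ s)) (y ∷ xs)))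
      ≡⟨ cong (suc ∘ length) (filter-reject (unselected? (y ∷ s)) (λ u → proj₂ u (here refl))) ⟩
    suc (length (filter (unselected? (y ∷ s)) xs))
      ≡⟨ cong (suc ∘ length) (filter-unselected-∷-∉ xs (All¬⇒¬Any y≢xs)) ⟩
    suc (length (filter (unselected? s) xs))
      ≡⟨ cong length (filter-accept (unselected? s) (Py , y∉s)) ⟨
    length (filter (unselected? s) (y ∷ xs)) ∎
  length-filter-unselected-∷ {y} {s} Py y∉s (x ∷ xs) (x≢xs ∷ unique) (there y∈xs)
    with unselected? s x
  ... | yes u = begin
    suc (length (filter (unselected? (y ∷ s)) (x ∷ xs)))
      ≡⟨ cong (suc ∘ length)
              (filter-accept (unselected? (y ∷ s)) (unselected-∷⁺ (All.lookup x≢xs y∈xs) u)) ⟩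
    suc (suc (length (filter (unselected? (y ∷ s)) xs)))
      ≡⟨ cong suc (length-filter-unselected-∷ Py y∉s xs unique y∈xs) ⟩
    suc (length (filter (unselected? s) xs))
      ≡⟨ cong length (filter-accept (unselected? s) u) ⟨
    length (filter (unselected? s) (x ∷ xs)) ∎
  ... | no ¬u = begin
    suc (length (filter (unselected? (y ∷ s)) (x ∷ xs)))
      ≡⟨ cong (suc ∘ length) (filter-reject (unselected? (y ∷ s)) (¬u ∘ unselected-∷⁻)) ⟩
    suc (length (filter (unselected? (y ∷ s)) xs))
      ≡⟨ length-filter-unselected-∷ Py y∉s xs unique y∈xs ⟩
    length (filter (unselected? s) xs)
      ≡⟨ cong length (filter-reject (unselected? s) ¬u) ⟨
    length (filter (unselected? s) (x ∷ xs)) ∎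

  unselected-∷ : ∀ {y s} → P y → y ∉ s → suc (unselected (y ∷ s)) ≡ unselected s
  unselected-∷ {y} Py y∉s = length-filter-unselected-∷ Py y∉s (allFin m) (allFin⁺ m) (∈-allFin y)

  unselected-nonempty : ∀ {s} → 0 < unselected s → ∃[ y ] Unselected s y
  unselected-nonempty {s} 0<u with filter (unselected? s) (allFin m) in eq
  unselected-nonempty () | []
  ... | y ∷ _ =
    y , proj₂ (∈-filter⁻ (unselected? s) {xs = allFin m} (subst (y ∈_) (sym eq) (here refl)))

unselected-U-∷ : ∀ {m y} {s : List (Fin m)} → y ∉ s → unselected U? (y ∷ s) < unselected U? s
unselected-U-∷ y∉s = ≤-reflexive (unselected-∷ U? tt y∉s)

module _ (G : Graph) where

  private
    V : Set
    V = Fin (n G)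

  adj-sym : ∀ {u v} → Adj G u v → Adj G v u
  adj-sym {u} {v} = subst T (Graph.sym G u v)

  adj⇒≢ : ∀ {u v} → Adj G u v → u ≢ v
  adj⇒≢ {u} uu refl = subst T (irrefl G u) uu

  isolated⊎neighbour : ∀ v → Isolated G v ⊎ ∃[ u ] Adj G u v
  isolated⊎neighbour v with any? (λ u → T? (adj G u v))
  ... | yes neighbour = inj₂ neighbour
  ... | no none = inj₁ λ u uv → none (u , uv)

  Connected : V → V → Set
  Connected u v = ∃[ k ] Walk G u v k

  _▷_ : ∀ {u v w k} → Walk G u v k → Adj G v w → Walk G u w (suc k)
  here ▷ vw = step vw here
  step uu′ p ▷ vw = step uu′ (p ▷ vw)

  reverse : ∀ {u v k} → Walk G u v k → Walk G v u k
  reverse here = here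
  reverse (step uw p) = reverse p ▷ adj-sym uw

  _++ʷ_ : ∀ {u v w k l} → Walk G u v k → Walk G v w l → Walk G u w (k + l)
  here ++ʷ q = q
  step uu′ p ++ʷ q = step uu′ (p ++ʷ q)

  connected-sym : ∀ {u v} → Connected u v → Connected v u
  connected-sym (k , p) = k , reverse p

  connected-trans : ∀ {u v w} → Connected u v → Connected v w → Connected u w
  connected-trans (k , p) (l , q) = k + l , p ++ʷ q

  isolated-connected : ∀ {x y} → Isolated G x → Connected x y → x ≡ y
  isolated-connected _ (_ , here) = refl
  isolated-connected ix (_ , step xw _) = ⊥-elim (ix _ (adj-sym xw))

  source∈verts : ∀ {u v k} (p : Walk G u v k) → u ∈ verts p
  source∈verts here = here refl
  source∈verts (step _ _) = here refl

  target∈verts : ∀ {u v k} (p : Walk G u v k) → v ∈ verts p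
  target∈verts here = here refl
  target∈verts (step _ p) = there (target∈verts p)

  ∈verts-▷ : ∀ {u v w k x} (p : Walk G u v k) (vw : Adj G v w) → x ∈ verts p → x ∈ verts (p ▷ vw)
  ∈verts-▷ here _ (here refl) = here refl
  ∈verts-▷ (step _ _) _ (here refl) = here refl
  ∈verts-▷ (step _ p) vw (there x∈p) = there (∈verts-▷ p vw x∈p)

  ∈verts⇒connected : ∀ {u v k x} (p : Walk G u v k) → x ∈ verts p → Connected u x
  ∈verts⇒connected here (here refl) = 0 , here
  ∈verts⇒connected (step _ _) (here refl) = 0 , here
  ∈verts⇒connected (step uw p) (there x∈p) with l , q ← ∈verts⇒connected p x∈p = suc l , step uw q

  onCommonShortestPath⇒connected : ∀ {x y z} → OnCommonShortestPath G x y z →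
    Connected x y × Connected x z × Connected y z
  onCommonShortestPath⇒connected (_ , _ , _ , p , _ , x∈p , y∈p , z∈p) =
    between x∈p y∈p , between x∈p z∈p , between y∈p z∈p
    where
    between : ∀ {a b} → a ∈ verts p → b ∈ verts p → Connected a b
    between a∈p b∈p =
      connected-trans (connected-sym (∈verts⇒connected p a∈p)) (∈verts⇒connected p b∈p)

  walk? : ∀ k u v → Dec (Walk G u v k)
  walk? zero u v with u ≟ᶠ v
  ... | yes refl = yes here
  ... | no u≢v = no λ { here → u≢v refl }
  walk? (suc k) u v with any? (λ w → T? (adj G u w) ×-dec walk? k w v)
  ... | yes (_ , uw , p) = yes (step uw p)
  ... | no none = no λ { (step uw p) → none (_ , uw , p) }

  shortestWalk : ∀ {u v k} → Walk G u v k → ∃[ d ] Σ (Walk G u v d) IsShortest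
  shortestWalk = go (<-wellFounded _)
    where
    go : ∀ {u v k} → Acc _<_ k → Walk G u v k → ∃[ d ] Σ (Walk G u v d) IsShortest
    go {u} {v} {k} (acc shorter) p with any? (λ (j : Fin k) → walk? (toℕ j) u v)
    ... | yes (j , q) = go (shorter (toℕ<n j)) q
    ... | no none = k , p , λ {l} q l<k →
      none (fromℕ< l<k , subst (Walk G u v) (sym (toℕ-fromℕ< l<k)) q)

  walk-colour : ∀ (c : V → Bool) → (∀ u v → Adj G u v → c u ≢ c v) →
    ∀ {u w k} → Walk G u w k → c w ≡ iterate not (c u) k
  walk-colour c proper here = refl
  walk-colour c proper {u} {k = suc k} (step {w = w} uw p) =
    trans (walk-colour c proper p) (cong (λ b → iterate not b k) (¬-not (≢-sym (proper u w uw))))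

  bipartite⇒onCommonShortestPath : Bipartite G → ∀ {a b v} → Adj G a b → Connected v a →
    OnCommonShortestPath G a b v
  bipartite⇒onCommonShortestPath (c , proper) {a} {b} {v} ab (_ , p)
    with da , pa , pa-shortest ← shortestWalk p
       | db , pb , pb-shortest ← shortestWalk (p ▷ ab)
    with <-cmp da db
  ... | tri< da<db _ _ =
    v , b , suc da , pa ▷ ab , (λ q l<1+da → pb-shortest q (≤-trans l<1+da da<db)) ,
    ∈verts-▷ pa ab (target∈verts pa) , target∈verts (pa ▷ ab) , source∈verts _
  ... | tri> _ _ db<da =
    v , a , suc db , pb ▷ adj-sym ab , (λ q l<1+db → pa-shortest q (≤-trans l<1+db db<da)) ,
    target∈verts (pb ▷ adj-sym ab) , ∈verts-▷ pb (adj-sym ab) (target∈verts pb) , source∈verts _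
  ... | tri≈ _ refl _ =
    ⊥-elim (proper a b ab (trans (walk-colour c proper pa) (sym (walk-colour c proper pb))))

  isGPSet-∷ : ∀ {a s} → IsGPSet G s →
    (∀ {y z} → y ∈ s → z ∈ s → y ≢ z → a ≢ y → a ≢ z → Connected a y → Connected a z → ⊥) →
    IsGPSet G (a ∷ s)
  isGPSet-∷ _ _ (here refl) (here refl) _ x≢y _ _ _ = x≢y refl
  isGPSet-∷ _ _ (here refl) (there _) (here refl) _ _ x≢z _ = x≢z refl
  isGPSet-∷ _ _ (there _) (here refl) (here refl) _ y≢z _ _ = y≢z refl
  isGPSet-∷ _ H (here refl) (there y∈s) (there z∈s) x≢y y≢z x≢z path
    with cxy , cxz , _ ← onCommonShortestPath⇒connected path = H y∈s z∈s y≢z x≢y x≢z cxy cxz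
  isGPSet-∷ _ H (there x∈s) (here refl) (there z∈s) x≢y y≢z x≢z path
    with cxy , _ , cyz ← onCommonShortestPath⇒connected path =
    H x∈s z∈s x≢z (≢-sym x≢y) y≢z (connected-sym cxy) cyz
  isGPSet-∷ _ H (there x∈s) (there y∈s) (here refl) x≢y y≢z x≢z path
    with _ , cxz , cyz ← onCommonShortestPath⇒connected path =
    H x∈s y∈s x≢y (≢-sym x≢z) (≢-sym y≢z) (connected-sym cxz) (connected-sym cyz)
  isGPSet-∷ gp _ (there x∈s) (there y∈s) (there z∈s) = gp x∈s y∈s z∈s

  isGPSet-∷-isolated : ∀ {w s} → Isolated G w → IsGPSet G s → IsGPSet G (w ∷ s)
  isGPSet-∷-isolated iw gp = isGPSet-∷ gp λ _ _ _ w≢y _ cwy _ → w≢y (isolated-connected iw cwy)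

  wins⇒¬loses : ∀ {s} → MoverWins G s → ¬ MoverLoses G s
  wins⇒¬loses (move v legal loses) (allMoves wins) = wins⇒¬loses (wins v legal) loses

  record Paired (s : List V) : Set where
    field
      generalPosition : IsGPSet G s
      matched : ∀ {x} → x ∈ s → ¬ Isolated G x → ∃[ y ] y ∈ s × Adj G x y

  open Paired

  paired-[] : Paired []
  paired-[] = record { generalPosition = λ () ; matched = λ () }

  Balanced : List V → Set
  Balanced s = Paired s × unselected (isolated? G) s % 2 ≡ 0

  paired-∷-isolated : ∀ {w s} → Isolated G w → Paired s → Paired (w ∷ s)
  paired-∷-isolated iw paired .generalPosition = isGPSet-∷-isolated iw (generalPosition paired)
  paired-∷-isolated iw paired .matched (here refl) ¬iw = ⊥-elim (¬iw iw)
  paired-∷-isolated iw paired .matched (there x∈s) ¬ix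
    with y , y∈s , xy ← matched paired x∈s ¬ix = y , there y∈s , xy

  paired-∷-edge : ∀ {u v s} → Adj G u v → IsGPSet G (u ∷ v ∷ s) → Paired s → Paired (u ∷ v ∷ s)
  paired-∷-edge uv gp paired .generalPosition = gp
  paired-∷-edge {u} {v} uv gp paired .matched (here refl) _ = v , there (here refl) , uv
  paired-∷-edge {u} {v} uv gp paired .matched (there (here refl)) _ = u , here refl , adj-sym uv
  paired-∷-edge uv gp paired .matched (there (there x∈s)) ¬ix
    with y , y∈s , xy ← matched paired x∈s ¬ix = y , there (there y∈s) , xy

  -- The matched partner y of a selected x in v's component would put x, y and v on a
  -- common shortest path.
  legal⇒disconnected : Bipartite G → ∀ {s v x} → Paired s → Legal G s v → x ∈ s → ¬ Connected v x
  legal⇒disconnected bip {s} {v} {x} paired (v∉s , gp) x∈s cvx with isolated? G x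
  ... | yes ix = v∉s (subst (_∈ s) (isolated-connected ix (connected-sym cvx)) x∈s)
  ... | no ¬ix with y , y∈s , xy ← matched paired x∈s ¬ix =
    gp (there x∈s) (there y∈s) (here refl)
       (adj⇒≢ xy) (λ { refl → v∉s y∈s }) (λ { refl → v∉s x∈s })
       (bipartite⇒onCommonShortestPath bip xy cvx)

  pickIsolated : ∀ {s} → Paired s → unselected (isolated? G) s % 2 ≡ 1 →
    ∃[ w ] Legal G s w × Balanced (w ∷ s)
  pickIsolated {s} paired odd
    with w , iw , w∉s ← unselected-nonempty (isolated? G) (m%2≡1⇒0<m _ odd) =
    w , (w∉s , isGPSet-∷-isolated iw (generalPosition paired)) , paired-∷-isolated iw paired ,
    1+m≡k⇒k%2≡1⇒m%2≡0 (unselected-∷ (isolated? G) iw w∉s) odd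

  respond : Bipartite G → ∀ {s v} → Balanced s → Legal G s v →
    ∃[ w ] Legal G (v ∷ s) w × Balanced (w ∷ v ∷ s)
  respond bip {s} {v} (paired , even) legal@(v∉s , gp) with isolated⊎neighbour v
  ... | inj₁ iv = pickIsolated (paired-∷-isolated iv paired)
    (1+m≡k⇒k%2≡0⇒m%2≡1 (unselected-∷ (isolated? G) iv v∉s) even)
  ... | inj₂ (u , uv) = u , (u∉v∷s , gpu) , paired-∷-edge uv gpu paired , even′
    where
    disconnected : ∀ {x} → x ∈ s → Connected u x → ⊥
    disconnected x∈s cux =
      legal⇒disconnected bip paired legal x∈s (connected-trans (1 , step (adj-sym uv) here) cux)
    u∉v∷s : u ∉ v ∷ s
    u∉v∷s (here u≡v) = adj⇒≢ uv u≡v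
    u∉v∷s (there u∈s) = disconnected u∈s (0 , here)
    gpu : IsGPSet G (u ∷ v ∷ s)
    gpu = isGPSet-∷ gp λ where
      (here refl) (here refl) y≢z _ _ _ _ → y≢z refl
      (here refl) (there z∈s) _ _ _ _ cuz → disconnected z∈s cuz
      (there y∈s) _ _ _ _ cuy _ → disconnected y∈s cuy
    even′ : unselected (isolated? G) (u ∷ v ∷ s) % 2 ≡ 0
    even′ = trans (cong (_% 2) (trans
      (unselected-∷-¬P (isolated? G) (v ∷ s) λ iu → iu v (adj-sym uv))
      (unselected-∷-¬P (isolated? G) s λ iv → iv u uv))) even

  balanced⇒loses : Bipartite G → ∀ {s} → Acc _<_ (unselected U? s) → Balanced s → MoverLoses G s
  balanced⇒loses bip (acc fewer) balanced = allMoves λ v legal →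
    let w , legal′ , balanced′ = respond bip balanced legal
    in move w legal′ (balanced⇒loses bip
         (fewer (<-trans (unselected-U-∷ (proj₁ legal′)) (unselected-U-∷ (proj₁ legal))))
         balanced′)

theorem2p5 : (G : Graph) → Bipartite G → AWins G ⇔ (numIsolated G % 2 ≡ 1)
theorem2p5 G bip = mk⇔ wins⇒odd odd⇒wins
  where
  isolatedCount : ∀ r → numIsolated G % 2 ≡ r → unselected (isolated? G) [] % 2 ≡ r
  isolatedCount r = subst (λ k → k % 2 ≡ r) (sym (unselected-[] (isolated? G)))

  wins⇒odd : AWins G → numIsolated G % 2 ≡ 1
  wins⇒odd aWins with m%2≡0⊎m%2≡1 (numIsolated G)
  ... | inj₂ odd = odd
  ... | inj₁ even = ⊥-elim (wins⇒¬loses G aWins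
    (balanced⇒loses G bip (<-wellFounded _) (paired-[] G , isolatedCount 0 even)))

  odd⇒wins : numIsolated G % 2 ≡ 1 → AWins G
  odd⇒wins odd with v , legal , balanced ← pickIsolated G (paired-[] G) (isolatedCount 1 odd) =
    move v legal (balanced⇒loses G bip (<-wellFounded _) balanced)
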